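{- Let $k=(k_1,k_2,k_3,k_4)\in(\mathbb{Z}\setminus[-2,2])^4$ satisfy: $k_1\equiv-1\pmod{16}$, $k_i\equiv5\pmod{16}$ for $2\le i\le4$, $k_1\equiv1\pmod 9$, $k_i\equiv5\pmod 9$ for $2\le i\le4$; $\gcd(k_i,k_j)=1$ and $\gcd(k_i^2-4,k_j^2-4)=3$ for all $1\le i\ne j\le4$; and $\gcd(k_1^2-2,k_2^2-2,k_3^2-2,k_4^2-2)=1$. Let $\mathcal{U}$ be the affine scheme over $\mathbb{Z}$ defined by $$x^2+y^2+z^2+xyz=ax+by+cz+d,$$ where $a=k_1k_2+k_3k_4$, $b=k_1k_4+k_2k_3$, $c=k_1k_3+k_2k_4$, $d=4-\sum_{i=1}^4k_i^2-\prod_{i=1}^4k_i$. Then $\mathcal{U}(\mathbf{A}_{\mathbb{Z}})\neq\emptyset$.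
   Context: $\mathcal{U}(\mathbf{A}_{\mathbb{Z}})=\prod_p\mathcal{U}(\mathbb{Z}_p)\times\pi_0(U(\mathbb{R}))$, the product over all primes $p$, where $U=\mathcal{U}\times_{\mathbb{Z}}\mathbb{Q}$ and $\pi_0$ denotes the set of connected components; nonemptiness means $\mathcal{U}(\mathbb{Z}_p)\ne\emptyset$ for all $p$ and $U(\mathbb{R})\ne\emptyset$. -}

module Defs where

open import Data.Nat as ℕ using (ℕ; suc; _^_)
open import Data.Nat.Primality using (Prime)
open import Data.Integer as ℤ using (ℤ; +_; -_; ∣_∣)
open import Data.Integer.Divisibility using (_∣_)
open import Data.Integer.GCD using (gcd)
open import Data.Rational as ℚ using (ℚ)
open import Data.Product using (Σ; _×_; ∃)
open import Relation.Binary.PropositionalEquality using (_≡_)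

_≡_[mod_] : ℤ → ℤ → ℤ → Set
a ≡ b [mod m ] = m ∣ (a ℤ.- b)

coefA coefB coefC coefD : ℤ → ℤ → ℤ → ℤ → ℤ
coefA k₁ k₂ k₃ k₄ = k₁ ℤ.* k₂ ℤ.+ k₃ ℤ.* k₄
coefB k₁ k₂ k₃ k₄ = k₁ ℤ.* k₄ ℤ.+ k₂ ℤ.* k₃
coefC k₁ k₂ k₃ k₄ = k₁ ℤ.* k₃ ℤ.+ k₂ ℤ.* k₄
coefD k₁ k₂ k₃ k₄ =
  + 4 ℤ.- (k₁ ℤ.* k₁ ℤ.+ k₂ ℤ.* k₂ ℤ.+ k₃ ℤ.* k₃ ℤ.+ k₄ ℤ.* k₄)
      ℤ.- k₁ ℤ.* k₂ ℤ.* k₃ ℤ.* k₄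

Fℤ : (a b c d : ℤ) → ℤ → ℤ → ℤ → ℤ
Fℤ a b c d x y z =
  (x ℤ.* x ℤ.+ y ℤ.* y ℤ.+ z ℤ.* z ℤ.+ x ℤ.* y ℤ.* z)
  ℤ.- (a ℤ.* x ℤ.+ b ℤ.* y ℤ.+ c ℤ.* z ℤ.+ d)

Fℚ : (a b c d : ℤ) → ℚ → ℚ → ℚ → ℚ
Fℚ a b c d x y z =
  (x ℚ.* x ℚ.+ y ℚ.* y ℚ.+ z ℚ.* z ℚ.+ x ℚ.* y ℚ.* z)
  ℚ.- ((a ℚ./ 1) ℚ.* x ℚ.+ (b ℚ./ 1) ℚ.* y ℚ.+ (c ℚ./ 1) ℚ.* z ℚ.+ (d ℚ./ 1))

-- ℤ_p = lim ℤ/pⁿ.  Since 𝒰 is affine, 𝒰(ℤ_p) = lim 𝒰(ℤ/pⁿ):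
-- a ℤ_p-point is a compatible system of points modulo pⁿ
-- (residues represented by integers).
ZpPoint : (p : ℕ) (a b c d : ℤ) → Set
ZpPoint p a b c d =
  Σ (ℕ → ℤ) λ x → Σ (ℕ → ℤ) λ y → Σ (ℕ → ℤ) λ z →
    (∀ n → x (suc n) ≡ x n [mod + (p ^ n) ]
         × y (suc n) ≡ y n [mod + (p ^ n) ]
         × z (suc n) ≡ z n [mod + (p ^ n) ])
    × (∀ n → Fℤ a b c d (x n) (y n) (z n) ≡ + 0 [mod + (p ^ n) ])

inv : ℕ → ℚ
inv n = + 1 ℚ./ suc n

-- A real number, as a regular Cauchy sequence of rationals (Bishop).
IsRegular : (ℕ → ℚ) → Set
IsRegular x = ∀ m n → ℚ.∣ x m ℚ.- x n ∣ ℚ.≤ inv m ℚ.+ inv n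

-- A real point of U: three reals (x,y,z) with F(x,y,z) = 0, i.e. the
-- rational sequence F(xₙ,yₙ,zₙ) converges to 0 (F is continuous).
RealPoint : (a b c d : ℤ) → Set
RealPoint a b c d =
  Σ (ℕ → ℚ) λ x → Σ (ℕ → ℚ) λ y → Σ (ℕ → ℚ) λ z →
    IsRegular x × IsRegular y × IsRegular z ×
    (∀ k → ∃ λ N → ∀ n → N ℕ.≤ n →
       ℚ.∣ Fℚ a b c d (x n) (y n) (z n) ∣ ℚ.≤ inv k)

-- 𝒰(𝐀_ℤ) ≠ ∅ : 𝒰(ℤ_p) ≠ ∅ for all primes p and U(ℝ) ≠ ∅
AdelicPointsNonempty : (a b c d : ℤ) → Set
AdelicPointsNonempty a b c d =
  (∀ p → Prime p → ZpPoint p a b c d) × RealPoint a b c d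

gcd4 : ℤ → ℤ → ℤ → ℤ → ℤ
gcd4 a b c d = gcd (gcd (gcd a b) c) d

OutsideMinus2To2 : ℤ → Set
OutsideMinus2To2 k = 2 ℕ.< ∣ k ∣

sq-4 sq-2 : ℤ → ℤ
sq-4 k = k ℤ.* k ℤ.- + 4
sq-2 k = k ℤ.* k ℤ.- + 2

PairCond : ℤ → ℤ → Set
PairCond u v = (gcd u v ≡ + 1) × (gcd (sq-4 u) (sq-4 v) ≡ + 3)

-- Each local condition is met on a curve along which F becomes easy to solve.
-- On the diagonal x = -2, y = z one has F = (4 + 2a - d) - (b + c) y; the congruences mod 9
-- make b + c three times a 3-adic unit and 3 ∣ 4 + 2a - d, which gives the 3-adic points and,
-- as b + c ≠ 0, a rational and hence real point. On the plane x = 5/2, z = w - 2y, 4F is linear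
-- in y with slope -6w - 4b + 8c, a p-adic unit for w = 0 or w = 1 when p ≥ 5. On the z-axis,
-- F = (z - c/2)² - (c²/4 + d) with c²/4 + d ≡ 1 (mod 8) by the congruences mod 16, and such
-- numbers are 2-adic squares. A linear congruence with unit slope is solved modulo pⁿ by Bézout,
-- and since the solution is unique modulo pⁿ the solutions form a coherent sequence.
module Submission where

open import Defs
open import Data.Nat as ℕ using (ℕ; zero; suc)
open import Data.Nat.Divisibility as ℕD using ()
open import Data.Nat.Coprimality as ℕC using (Coprime; coprime-divisor; 1-coprimeTo)
open import Data.Nat.GCD using (module Bézout)
open import Data.Nat.Primality
  using (Prime; prime?; prime[2]; prime⇒irreducible; prime⇒nonTrivial; euclidsLemma)
open import Data.Integer using (ℤ; +_; -_; -[1+_]; _+_; _-_; _*_; ∣_∣)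
import Data.Integer.Properties as ℤP
open import Data.Integer.Divisibility.Signed
  using (_∣_; divides; ∣ᵤ⇒∣; ∣⇒∣ᵤ; ∣-trans; ∣m∣n⇒∣m+n; ∣m∣n⇒∣m-n; ∣m+n∣m⇒∣n; ∣m⇒∣m*n; ∣m⇒∣-m; ∣n⇒∣m*n)
import Data.Integer.Coprimality as ℤC
open import Data.Integer.DivMod using (_/_; _%_; a≡a%n+[a/n]*n; n%d<d)
open import Data.Integer.GCD using (gcd; gcd-zeroʳ)
open import Data.Integer.Tactic.RingSolver using (solve-∀)
open import Data.Rational as ℚ using (ℚ; 0ℚ; 1ℚ)
import Data.Rational.Properties as ℚP
open import Data.Rational.Unnormalised as ℚᵘ using (mkℚᵘ; *≡*)
import Data.Rational.Unnormalised.Properties as ℚᵘP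
open import Tactic.RingSolver.Core.AlmostCommutativeRing
  using (AlmostCommutativeRing; fromCommutativeRing)
import Tactic.RingSolver as RingSolver
open import Data.Product using (Σ; ∃; _×_; _,_; proj₁; proj₂)
open import Data.Sum using (_⊎_; inj₁; inj₂)
open import Data.Maybe using (nothing)
open import Data.Empty using (⊥-elim)
open import Data.Unit using (tt)
open import Level using (0ℓ)
open import Function using (_$_)
open import Relation.Nullary using (¬_; yes; no)
open import Relation.Nullary.Decidable using (toWitness; toWitnessFalse)
open import Relation.Binary.PropositionalEquality
  using (_≡_; _≢_; refl; sym; trans; cong; cong₂; subst; module ≡-Reasoning)

-- Congruences

-- Congruence as a record, so that unification can recover m, a and b.
infix 4 _≅_⟨mod_⟩
record _≅_⟨mod_⟩ (a b m : ℤ) : Set where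
  constructor congruent
  field divides-difference : m ∣ a - b

≅⇒≡-mod : ∀ {a b m} → a ≅ b ⟨mod m ⟩ → a ≡ b [mod m ]
≅⇒≡-mod {a} {b} (congruent m∣a-b) = ∣⇒∣ᵤ {i = a - b} m∣a-b

≡-mod⇒≅ : ∀ {m} a b → a ≡ b [mod m ] → a ≅ b ⟨mod m ⟩
≡-mod⇒≅ a b a≡b = congruent (∣ᵤ⇒∣ {i = a - b} a≡b)

module _ {m : ℤ} where

  ≅-by : ∀ {a b} x → a - b ≡ x → m ∣ x → a ≅ b ⟨mod m ⟩
  ≅-by x eq m∣x = congruent (subst (m ∣_) (sym eq) m∣x)

  ≅-refl : ∀ {a} → a ≅ a ⟨mod m ⟩
  ≅-refl {a} = ≅-by (+ 0) (ℤP.+-inverseʳ a) (divides (+ 0) refl)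

  ≅-trans : ∀ {a b c} → a ≅ b ⟨mod m ⟩ → b ≅ c ⟨mod m ⟩ → a ≅ c ⟨mod m ⟩
  ≅-trans {a} {b} {c} (congruent p) (congruent q) = ≅-by _ (lemma a b c) (∣m∣n⇒∣m+n p q)
    where
    lemma : ∀ a b c → a - c ≡ (a - b) + (b - c)
    lemma = solve-∀

  +-cong : ∀ {a a′ b b′} → a ≅ a′ ⟨mod m ⟩ → b ≅ b′ ⟨mod m ⟩ → a + b ≅ a′ + b′ ⟨mod m ⟩
  +-cong {a} {a′} {b} {b′} (congruent p) (congruent q) = ≅-by _ (lemma a a′ b b′) (∣m∣n⇒∣m+n p q)
    where
    lemma : ∀ a a′ b b′ → (a + b) - (a′ + b′) ≡ (a - a′) + (b - b′)
    lemma = solve-∀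

  *-cong : ∀ {a a′ b b′} → a ≅ a′ ⟨mod m ⟩ → b ≅ b′ ⟨mod m ⟩ → a * b ≅ a′ * b′ ⟨mod m ⟩
  *-cong {a} {a′} {b} {b′} (congruent p) (congruent q) =
    ≅-by _ (lemma a a′ b b′) (∣m∣n⇒∣m+n (∣n⇒∣m*n b p) (∣n⇒∣m*n a′ q))
    where
    lemma : ∀ a a′ b b′ → a * b - a′ * b′ ≡ b * (a - a′) + a′ * (b - b′)
    lemma = solve-∀

  -‿cong : ∀ {a a′} → a ≅ a′ ⟨mod m ⟩ → - a ≅ - a′ ⟨mod m ⟩
  -‿cong {a} {a′} (congruent p) = ≅-by _ (lemma a a′) (∣m⇒∣-m p)
    where
    lemma : ∀ a a′ → - a - - a′ ≡ - (a - a′)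
    lemma = solve-∀

  -cong : ∀ {a a′ b b′} → a ≅ a′ ⟨mod m ⟩ → b ≅ b′ ⟨mod m ⟩ → a - b ≅ a′ - b′ ⟨mod m ⟩
  -cong p q = +-cong p (-‿cong q)

≅-weaken : ∀ {a b m m′} → m ∣ m′ → a ≅ b ⟨mod m′ ⟩ → a ≅ b ⟨mod m ⟩
≅-weaken m∣m′ (congruent p) = congruent (∣-trans m∣m′ p)

module _ {m k₁ k₂ k₃ k₄ l₁ l₂ l₃ l₄ : ℤ}
         (h₁ : k₁ ≅ l₁ ⟨mod m ⟩) (h₂ : k₂ ≅ l₂ ⟨mod m ⟩)
         (h₃ : k₃ ≅ l₃ ⟨mod m ⟩) (h₄ : k₄ ≅ l₄ ⟨mod m ⟩) where

  coefA-cong : coefA k₁ k₂ k₃ k₄ ≅ coefA l₁ l₂ l₃ l₄ ⟨mod m ⟩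
  coefA-cong = +-cong (*-cong h₁ h₂) (*-cong h₃ h₄)

  coefB-cong : coefB k₁ k₂ k₃ k₄ ≅ coefB l₁ l₂ l₃ l₄ ⟨mod m ⟩
  coefB-cong = +-cong (*-cong h₁ h₄) (*-cong h₂ h₃)

  coefC-cong : coefC k₁ k₂ k₃ k₄ ≅ coefC l₁ l₂ l₃ l₄ ⟨mod m ⟩
  coefC-cong = +-cong (*-cong h₁ h₃) (*-cong h₂ h₄)

  coefD-cong : coefD k₁ k₂ k₃ k₄ ≅ coefD l₁ l₂ l₃ l₄ ⟨mod m ⟩
  coefD-cong =
    -cong (-cong (≅-refl {a = + 4}) (+-cong (+-cong (+-cong (*-cong h₁ h₁) (*-cong h₂ h₂))
                                        (*-cong h₃ h₃)) (*-cong h₄ h₄)))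
          (*-cong (*-cong (*-cong h₁ h₂) h₃) h₄)

-- At k = (-1, 5, 5, 5): c = 20 and d = 53.
residues-mod-8 : ∀ {k₁ k₂ k₃ k₄} →
  k₁ ≅ - + 1 ⟨mod + 8 ⟩ → k₂ ≅ + 5 ⟨mod + 8 ⟩ → k₃ ≅ + 5 ⟨mod + 8 ⟩ → k₄ ≅ + 5 ⟨mod + 8 ⟩ →
  coefC k₁ k₂ k₃ k₄ ≅ + 4 ⟨mod + 8 ⟩ × coefD k₁ k₂ k₃ k₄ ≅ + 5 ⟨mod + 8 ⟩
residues-mod-8 h₁ h₂ h₃ h₄ =
  ≅-trans (coefC-cong h₁ h₂ h₃ h₄) (congruent (divides (+ 2) refl)) ,
  ≅-trans (coefD-cong h₁ h₂ h₃ h₄) (congruent (divides (+ 6) refl))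

-- At k = (1, 5, 5, 5): b + c = 60 and 4 + 2a - d = 261.
residues-mod-9 : ∀ {k₁ k₂ k₃ k₄} →
  k₁ ≅ + 1 ⟨mod + 9 ⟩ → k₂ ≅ + 5 ⟨mod + 9 ⟩ → k₃ ≅ + 5 ⟨mod + 9 ⟩ → k₄ ≅ + 5 ⟨mod + 9 ⟩ →
  coefB k₁ k₂ k₃ k₄ + coefC k₁ k₂ k₃ k₄ ≅ + 6 ⟨mod + 9 ⟩ ×
  + 4 + + 2 * coefA k₁ k₂ k₃ k₄ - coefD k₁ k₂ k₃ k₄ ≅ + 0 ⟨mod + 9 ⟩
residues-mod-9 h₁ h₂ h₃ h₄ =
  ≅-trans (+-cong (coefB-cong h₁ h₂ h₃ h₄) (coefC-cong h₁ h₂ h₃ h₄)) (congruent (divides (+ 6) refl)) ,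
  ≅-trans (-cong (+-cong (≅-refl {a = + 4}) (*-cong (≅-refl {a = + 2}) (coefA-cong h₁ h₂ h₃ h₄)))
                 (coefD-cong h₁ h₂ h₃ h₄))
          (congruent (divides (+ 29) refl))

≅6-mod-9⇒≢0 : ∀ {x} → x ≅ + 6 ⟨mod + 9 ⟩ → x ≢ + 0
≅6-mod-9⇒≢0 (congruent 9∣x-6) refl = toWitnessFalse {a? = 9 ℕD.∣? 6} tt (∣⇒∣ᵤ 9∣x-6)

-- Units modulo prime powers

coprime-* : ∀ {m n k} → Coprime m k → Coprime n k → Coprime (m ℕ.* n) k
coprime-* m⊥k n⊥k (d∣mn , d∣k) =
  n⊥k (coprime-divisor (λ (e∣d , e∣m) → m⊥k (e∣m , ℕD.∣-trans e∣d d∣k)) d∣mn , d∣k)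

prime∤⇒coprime : ∀ {p n} → Prime p → ¬ p ℕD.∣ n → Coprime p n
prime∤⇒coprime pr p∤n (d∣p , d∣n) with prime⇒irreducible pr d∣p
... | inj₁ d≡1 = d≡1
... | inj₂ refl = ⊥-elim (p∤n d∣n)

coprime-^ : ∀ {p n} → Coprime p n → ∀ e → Coprime (p ℕ.^ e) n
coprime-^ {n = n} p⊥n zero = 1-coprimeTo n
coprime-^ p⊥n (suc e) = coprime-* p⊥n (coprime-^ p⊥n e)

ℤ-Bézout : ∀ a b c d → 1 ℕ.+ a ℕ.* b ≡ c ℕ.* d → + 1 + + a * + b ≡ + c * + d
ℤ-Bézout a b c d eq = begin
  + 1 + + a * + b   ≡⟨ cong (λ t → + 1 + t) (ℤP.pos-* a b) ⟨
  + (1 ℕ.+ a ℕ.* b) ≡⟨ cong +_ eq ⟩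
  + (c ℕ.* d)       ≡⟨ ℤP.pos-* c d ⟩
  + c * + d         ∎
  where open ≡-Reasoning

inverse-mod : ∀ {m} D → Coprime m ∣ D ∣ → ∃ λ u → + m ∣ D * u - + 1
inverse-mod {m} (+ n) m⊥n with ℕC.coprime-Bézout m⊥n
... | Bézout.+- x y eq = - + y , divides (- + x) (begin
  + n * - + y - + 1   ≡⟨ lemma (+ n) (+ y) ⟩
  - (+ 1 + + y * + n) ≡⟨ cong -_ (ℤ-Bézout y n x m eq) ⟩
  - (+ x * + m)       ≡⟨ ℤP.neg-distribˡ-* (+ x) (+ m) ⟩
  - + x * + m         ∎)
  where
  open ≡-Reasoning
  lemma : ∀ n y → n * - y - + 1 ≡ - (+ 1 + y * n)
  lemma = solve-∀
... | Bézout.-+ x y eq = + y , divides (+ x) (begin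
  + n * + y - + 1       ≡⟨ cong (_- + 1) (ℤP.*-comm (+ n) (+ y)) ⟩
  + y * + n - + 1       ≡⟨ cong (_- + 1) (ℤ-Bézout x m y n eq) ⟨
  + 1 + + x * + m - + 1 ≡⟨ lemma (+ x * + m) ⟩
  + x * + m             ∎)
  where
  open ≡-Reasoning
  lemma : ∀ a → + 1 + a - + 1 ≡ a
  lemma = solve-∀
inverse-mod -[1+ n ] m⊥n with inverse-mod (+ suc n) m⊥n
... | u , m∣D*u-1 = - u , subst (λ t → _ ∣ t - + 1) (lemma (+ suc n) u) m∣D*u-1
  where
  lemma : ∀ a u → a * u ≡ - a * - u
  lemma = solve-∀

prime∣prime⇒≡ : ∀ {p q} → Prime p → Prime q → p ℕD.∣ q → p ≡ q
prime∣prime⇒≡ {p} pr-p pr-q p∣q with prime⇒irreducible pr-q p∣q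
... | inj₁ p≡1 = ⊥-elim (ℕ.nonTrivial⇒≢1 {{prime⇒nonTrivial pr-p}} p≡1)
... | inj₂ p≡q = p≡q

prime[3] : Prime 3
prime[3] = toWitness {a? = prime? 3} tt

-- Coherent sequences of approximations

_^ᶻ_ : ℕ → ℕ → ℤ
p ^ᶻ n = + (p ℕ.^ n)

Coherent : ℕ → (ℕ → ℤ) → Set
Coherent p f = ∀ n → f (suc n) ≅ f n ⟨mod p ^ᶻ n ⟩

p^n∣p^[1+n] : ∀ p n → p ^ᶻ n ∣ p ^ᶻ suc n
p^n∣p^[1+n] p n = ∣ᵤ⇒∣ (ℕD.n∣m*n p)

solution-unique : ∀ {m} D E y′ y → Coprime m ∣ D ∣ →
                  + m ∣ D * y′ + E → + m ∣ D * y + E → y′ ≅ y ⟨mod + m ⟩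
solution-unique {m} D E y′ y m⊥D m∣Dy′+E m∣Dy+E = ≡-mod⇒≅ y′ y $
  ℤC.coprime-divisor (+ m) D (y′ - y) m⊥D
    (∣⇒∣ᵤ (subst (+ m ∣_) (lemma D E y y′) (∣m∣n⇒∣m-n m∣Dy′+E m∣Dy+E)))
  where
  lemma : ∀ D E y y′ → (D * y′ + E) - (D * y + E) ≡ D * (y′ - y)
  lemma = solve-∀

LinearSolution : ℕ → ℤ → ℤ → Set
LinearSolution p D E = Σ (ℕ → ℤ) λ y → Coherent p y × (∀ n → p ^ᶻ n ∣ D * y n + E)

linear-solution : ∀ {p} D E → Prime p → ¬ p ℕD.∣ ∣ D ∣ → LinearSolution p D E
linear-solution {p} D E pr p∤D = y , coherent , solves
  where
  p^n⊥D : ∀ n → Coprime (p ℕ.^ n) ∣ D ∣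
  p^n⊥D = coprime-^ (prime∤⇒coprime pr p∤D)
  y : ℕ → ℤ
  y n = - (E * proj₁ (inverse-mod D (p^n⊥D n)))
  lemma : ∀ D E u → - E * (D * u - + 1) ≡ D * - (E * u) + E
  lemma = solve-∀
  solves : ∀ n → p ^ᶻ n ∣ D * y n + E
  solves n with inverse-mod D (p^n⊥D n)
  ... | u , p^n∣Du-1 = subst (_ ∣_) (lemma D E u) (∣n⇒∣m*n (- E) p^n∣Du-1)
  coherent : Coherent p y
  coherent n = solution-unique D E (y (suc n)) (y n) (p^n⊥D n) (∣-trans (p^n∣p^[1+n] p n) (solves (suc n))) (solves n)

parity : ∀ q → ∃ λ h → q ≡ h * + 2 ⊎ q ≡ h * + 2 + + 1
parity q with q % + 2 | a≡a%n+[a/n]*n q (+ 2) | n%d<d q (+ 2)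
... | 0           | eq | _ = q / + 2 , inj₁ (trans eq (ℤP.+-identityˡ _))
... | 1           | eq | _ = q / + 2 , inj₂ (trans eq (ℤP.+-comm (+ 1) ((q / + 2) * + 2)))
... | suc (suc _) | _  | ℕ.s≤s (ℕ.s≤s ())

odd : ℤ → ℤ
odd r = + 2 * r + + 1

module OddSquareRoot (t : ℤ) where

  A : ℤ
  A = + 1 + + 8 * t

  Approximation : ℕ → Set
  Approximation n = Σ ℤ λ r → ∃ λ q → odd r * odd r - A ≡ q * (+ 8 * 2 ^ᶻ n)

  -- Hensel's step: if the quotient is odd, move the root by 2ⁿ⁺².
  refine : ∀ n → (a : Approximation n) →
           Σ (Approximation (suc n)) λ a′ → proj₁ a′ ≅ proj₁ a ⟨mod 2 ^ᶻ n ⟩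
  refine n (r , q , eq) with parity q
  ... | h , inj₁ q≡2h = (r , h , even-case) , ≅-refl
    where
    open ≡-Reasoning
    lemma : ∀ h P → h * + 2 * (+ 8 * P) ≡ h * (+ 8 * (+ 2 * P))
    lemma = solve-∀
    even-case : odd r * odd r - A ≡ h * (+ 8 * 2 ^ᶻ suc n)
    even-case = begin
      odd r * odd r - A                ≡⟨ eq ⟩
      q * (+ 8 * 2 ^ᶻ n)               ≡⟨ cong (λ t → t * (+ 8 * 2 ^ᶻ n)) q≡2h ⟩
      h * + 2 * (+ 8 * 2 ^ᶻ n)         ≡⟨ lemma h (2 ^ᶻ n) ⟩
      h * (+ 8 * (+ 2 * 2 ^ᶻ n))       ≡⟨ cong (λ t → h * (+ 8 * t)) (ℤP.pos-* 2 (2 ℕ.^ n)) ⟨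
      h * (+ 8 * 2 ^ᶻ suc n)           ∎
  ... | h , inj₂ q≡2h+1 = (r′ , q′ , odd-case) , ≅-by _ (lemma₁ r (2 ^ᶻ n)) (divides (+ 2) refl)
    where
    open ≡-Reasoning
    r′ q′ : ℤ
    r′ = r + + 2 * 2 ^ᶻ n
    q′ = h + r + + 1 + 2 ^ᶻ n
    lemma₁ : ∀ r P → (r + + 2 * P) - r ≡ + 2 * P
    lemma₁ = solve-∀
    lemma₂ : ∀ r A P →
      (+ 2 * (r + + 2 * P) + + 1) * (+ 2 * (r + + 2 * P) + + 1) - A
      ≡ ((+ 2 * r + + 1) * (+ 2 * r + + 1) - A) + + 8 * P * (+ 2 * r + + 1 + + 2 * P)
    lemma₂ = solve-∀
    lemma₃ : ∀ h r P → (h * + 2 + + 1) * (+ 8 * P) + + 8 * P * (+ 2 * r + + 1 + + 2 * P)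
                       ≡ (h + r + + 1 + P) * (+ 8 * (+ 2 * P))
    lemma₃ = solve-∀
    odd-case : odd r′ * odd r′ - A ≡ q′ * (+ 8 * 2 ^ᶻ suc n)
    odd-case = begin
      odd r′ * odd r′ - A
        ≡⟨ lemma₂ r A (2 ^ᶻ n) ⟩
      (odd r * odd r - A) + + 8 * 2 ^ᶻ n * (odd r + + 2 * 2 ^ᶻ n)
        ≡⟨ cong (λ t → t + + 8 * 2 ^ᶻ n * (odd r + + 2 * 2 ^ᶻ n)) (trans eq (cong (λ t → t * (+ 8 * 2 ^ᶻ n)) q≡2h+1)) ⟩
      (h * + 2 + + 1) * (+ 8 * 2 ^ᶻ n) + + 8 * 2 ^ᶻ n * (odd r + + 2 * 2 ^ᶻ n)
        ≡⟨ lemma₃ h r (2 ^ᶻ n) ⟩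
      q′ * (+ 8 * (+ 2 * 2 ^ᶻ n))
        ≡⟨ cong (λ t → q′ * (+ 8 * t)) (ℤP.pos-* 2 (2 ℕ.^ n)) ⟨
      q′ * (+ 8 * 2 ^ᶻ suc n) ∎

  approximation : ∀ n → Approximation n
  approximation zero = + 0 , - t , lemma t
    where
    lemma : ∀ t → (+ 2 * + 0 + + 1) * (+ 2 * + 0 + + 1) - (+ 1 + + 8 * t) ≡ - t * (+ 8 * + 1)
    lemma = solve-∀
  approximation (suc n) = proj₁ (refine n (approximation n))

SquareRoot₂ : ℤ → Set
SquareRoot₂ A = Σ (ℕ → ℤ) λ w → Coherent 2 w × (∀ n → 2 ^ᶻ n ∣ w n * w n - A)

odd-square-root : ∀ t → SquareRoot₂ (+ 1 + + 8 * t)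
odd-square-root t = w , coherent , solves
  where
  open OddSquareRoot t
  w : ℕ → ℤ
  w n = odd (proj₁ (approximation n))
  coherent : Coherent 2 w
  coherent n = +-cong (*-cong (≅-refl {a = + 2}) (proj₂ (refine n (approximation n)))) (≅-refl {a = + 1})
  solves : ∀ n → 2 ^ᶻ n ∣ w n * w n - A
  solves n with approximation n
  ... | r , q , eq = divides (q * + 8) (trans eq (sym (ℤP.*-assoc q (+ 8) (2 ^ᶻ n))))

-- Local points

coherent-const : ∀ {p} x → Coherent p (λ _ → x)
coherent-const x n = ≅-refl {a = x}

∣⇒≡0-mod : ∀ {m} x → m ∣ x → x ≡ + 0 [mod m ]
∣⇒≡0-mod x m∣x = ∣⇒∣ᵤ {i = x - + 0} (subst (_ ∣_) (sym (ℤP.+-identityʳ x)) m∣x)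

ZpPoint-intro : ∀ {p} a b c d x y z → Coherent p x → Coherent p y → Coherent p z →
  (∀ n → p ^ᶻ n ∣ Fℤ a b c d (x n) (y n) (z n)) → ZpPoint p a b c d
ZpPoint-intro a b c d x y z x-coh y-coh z-coh p^n∣F =
  x , y , z , (λ n → ≅⇒≡-mod (x-coh n) , ≅⇒≡-mod (y-coh n) , ≅⇒≡-mod (z-coh n)) , λ n → ∣⇒≡0-mod _ (p^n∣F n)

i-j≡k⇒i≡k+j : ∀ i j {k} → i - j ≡ k → i ≡ k + j
i-j≡k⇒i≡k+j i j eq = trans (lemma i j) (cong (_+ j) eq)
  where
  lemma : ∀ i j → i ≡ (i - j) + j
  lemma = solve-∀

ZpPoint-axis : ∀ a b c d → c ≅ + 4 ⟨mod + 8 ⟩ → d ≅ + 5 ⟨mod + 8 ⟩ → ZpPoint 2 a b c d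
ZpPoint-axis a b c d (congruent (divides q c-4≡8q)) (congruent (divides q′ d-5≡8q′)) =
  ZpPoint-intro a b c d (λ _ → + 0) (λ _ → + 0) z (coherent-const (+ 0)) (coherent-const (+ 0)) z-coh 2^n∣F
  where
  open ≡-Reasoning
  -- h = c/2 and 1 + 8t = h² + d
  t h : ℤ
  t = + 2 * q * q + + 2 * q + q′ + + 1
  h = + 4 * q + + 2
  root : SquareRoot₂ (+ 1 + + 8 * t)
  root = odd-square-root t
  w z : ℕ → ℤ
  w = proj₁ root
  z n = w n + h
  z-coh : Coherent 2 z
  z-coh n = +-cong (proj₁ (proj₂ root) n) (≅-refl {a = h})
  expanded : ∀ a b q q′ w →
    ((+ 0 * + 0 + + 0 * + 0 + (w + (+ 4 * q + + 2)) * (w + (+ 4 * q + + 2)) + + 0 * + 0 * (w + (+ 4 * q + + 2)))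
     - (a * + 0 + b * + 0 + (q * + 8 + + 4) * (w + (+ 4 * q + + 2)) + (q′ * + 8 + + 5)))
    ≡ w * w - (+ 1 + + 8 * (+ 2 * q * q + + 2 * q + q′ + + 1))
  expanded = solve-∀
  F-axis : ∀ n → Fℤ a b c d (+ 0) (+ 0) (z n) ≡ w n * w n - (+ 1 + + 8 * t)
  F-axis n = begin
    Fℤ a b c d (+ 0) (+ 0) (z n)
      ≡⟨ cong₂ (λ c d → Fℤ a b c d (+ 0) (+ 0) (z n)) (i-j≡k⇒i≡k+j c (+ 4) c-4≡8q) (i-j≡k⇒i≡k+j d (+ 5) d-5≡8q′) ⟩
    Fℤ a b (q * + 8 + + 4) (q′ * + 8 + + 5) (+ 0) (+ 0) (z n)
      ≡⟨ expanded a b q q′ (w n) ⟩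
    w n * w n - (+ 1 + + 8 * t) ∎
  2^n∣F : ∀ n → 2 ^ᶻ n ∣ Fℤ a b c d (+ 0) (+ 0) (z n)
  2^n∣F n = subst (_ ∣_) (sym (F-axis n)) (proj₂ (proj₂ root) n)

ZpPoint-diagonal : ∀ {p} a b c d s D → Prime p → ¬ p ℕD.∣ ∣ D ∣ →
  b + c ≡ s * D → s ∣ + 4 + + 2 * a - d → ZpPoint p a b c d
ZpPoint-diagonal {p} a b c d s D pr p∤D b+c≡sD (divides E N≡Es) =
  ZpPoint-intro a b c d (λ _ → - + 2) y y (coherent-const (- + 2)) y-coh y-coh p^n∣F
  where
  open ≡-Reasoning
  solution : LinearSolution p D (- E)
  solution = linear-solution D (- E) pr p∤D
  y : ℕ → ℤ
  y = proj₁ solution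
  y-coh : Coherent p y
  y-coh = proj₁ (proj₂ solution)
  expanded : ∀ a b c d y →
    (- + 2 * - + 2 + y * y + y * y + - + 2 * y * y) - (a * - + 2 + b * y + c * y + d)
    ≡ (+ 4 + + 2 * a - d) - (b + c) * y
  expanded = solve-∀
  lemma : ∀ s D E y → E * s - s * D * y ≡ - s * (D * y + - E)
  lemma = solve-∀
  F-diagonal : ∀ n → Fℤ a b c d (- + 2) (y n) (y n) ≡ - s * (D * y n + - E)
  F-diagonal n = begin
    Fℤ a b c d (- + 2) (y n) (y n)          ≡⟨ expanded a b c d (y n) ⟩
    (+ 4 + + 2 * a - d) - (b + c) * y n     ≡⟨ cong₂ (λ N S → N - S * y n) N≡Es b+c≡sD ⟩
    E * s - s * D * y n                     ≡⟨ lemma s D E (y n) ⟩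
    - s * (D * y n + - E)                   ∎
  p^n∣F : ∀ n → p ^ᶻ n ∣ Fℤ a b c d (- + 2) (y n) (y n)
  p^n∣F n = subst (_ ∣_) (sym (F-diagonal n)) (∣n⇒∣m*n (- s) (proj₂ (proj₂ solution) n))

ZpPoint-3 : ∀ a b c d → b + c ≅ + 6 ⟨mod + 9 ⟩ → + 4 + + 2 * a - d ≅ + 0 ⟨mod + 9 ⟩ →
            ZpPoint 3 a b c d
ZpPoint-3 a b c d (congruent (divides q b+c-6≡9q)) (congruent 9∣N-0) =
  ZpPoint-diagonal a b c d (+ 3) (q * + 3 + + 2) prime[3] 3∤D b+c≡3D 3∣N
  where
  lemma : ∀ q → q * + 9 + + 6 ≡ + 3 * (q * + 3 + + 2)
  lemma = solve-∀
  b+c≡3D : b + c ≡ + 3 * (q * + 3 + + 2)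
  b+c≡3D = trans (i-j≡k⇒i≡k+j (b + c) (+ 6) b+c-6≡9q) (lemma q)
  3∣N : + 3 ∣ + 4 + + 2 * a - d
  3∣N = ∣-trans (divides (+ 3) refl) (subst (+ 9 ∣_) (ℤP.+-identityʳ _) 9∣N-0)
  3∤D : ¬ 3 ℕD.∣ ∣ q * + 3 + + 2 ∣
  3∤D 3∣D = toWitnessFalse {a? = 3 ℕD.∣? 2} tt
              (∣⇒∣ᵤ (∣m+n∣m⇒∣n (∣ᵤ⇒∣ {i = q * + 3 + + 2} 3∣D) (divides q refl)))

slope : ℤ → ℤ → ℤ → ℤ
slope b c w = - + 6 * w - + 4 * b + + 8 * c

offset : ℤ → ℤ → ℤ → ℤ → ℤ
offset a c d w = + 4 * w * w - + 4 * c * w + + 25 - + 10 * a - + 4 * d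

-- slope b c 0 - slope b c 1 = 6, so one of them is prime to p.
slope-coprime : ∀ {p} b c → Prime p → p ≢ 2 → p ≢ 3 → ∃ λ w → ¬ p ℕD.∣ ∣ slope b c w ∣
slope-coprime {p} b c pr p≢2 p≢3
  with p ℕD.∣? ∣ slope b c (+ 0) ∣ | p ℕD.∣? ∣ slope b c (+ 1) ∣
... | no p∤s₀ | _ = + 0 , p∤s₀
... | yes _ | no p∤s₁ = + 1 , p∤s₁
... | yes p∣s₀ | yes p∣s₁ with euclidsLemma 2 3 pr p∣6
  where
  lemma : ∀ b c → (- + 6 * + 0 - + 4 * b + + 8 * c) - (- + 6 * + 1 - + 4 * b + + 8 * c) ≡ + 6
  lemma = solve-∀
  p∣6 : p ℕD.∣ 6
  p∣6 = ∣⇒∣ᵤ (subst (+ p ∣_) (lemma b c)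
          (∣m∣n⇒∣m-n (∣ᵤ⇒∣ {i = slope b c (+ 0)} p∣s₀) (∣ᵤ⇒∣ {i = slope b c (+ 1)} p∣s₁)))
... | inj₁ p∣2 = ⊥-elim (p≢2 (prime∣prime⇒≡ pr prime[2] p∣2))
... | inj₂ p∣3 = ⊥-elim (p≢3 (prime∣prime⇒≡ pr prime[3] p∣3))

-- On the plane z = w - 2y, the terms of F quadratic in y cancel exactly when x = 5/2.
ZpPoint-plane : ∀ {p} a b c d → Prime p → p ≢ 2 → p ≢ 3 → ZpPoint p a b c d
ZpPoint-plane {p} a b c d pr p≢2 p≢3 with slope-coprime b c pr p≢2 p≢3
... | w , p∤slope =
  ZpPoint-intro a b c d x y z (proj₁ (proj₂ xs)) (proj₁ (proj₂ ys)) z-coh p^n∣F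
  where
  p∤2 : ¬ p ℕD.∣ 2
  p∤2 p∣2 = p≢2 (prime∣prime⇒≡ pr prime[2] p∣2)
  p∤4 : ¬ p ℕD.∣ 4
  p∤4 p∣4 with euclidsLemma 2 2 pr p∣4
  ... | inj₁ p∣2 = p∤2 p∣2
  ... | inj₂ p∣2 = p∤2 p∣2
  xs : LinearSolution p (+ 2) (- + 5)
  xs = linear-solution (+ 2) (- + 5) pr p∤2
  ys : LinearSolution p (slope b c w) (offset a c d w)
  ys = linear-solution (slope b c w) (offset a c d w) pr p∤slope
  x y z : ℕ → ℤ
  x = proj₁ xs
  y = proj₁ ys
  z n = w - + 2 * y n
  z-coh : Coherent p z
  z-coh n = -cong (≅-refl {a = w}) (*-cong (≅-refl {a = + 2}) (proj₁ (proj₂ ys) n))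
  expanded : ∀ a b c d x y w →
    + 4 * ((x * x + y * y + (w - + 2 * y) * (w - + 2 * y) + x * y * (w - + 2 * y))
           - (a * x + b * y + c * (w - + 2 * y) + d))
    ≡ ((- + 6 * w - + 4 * b + + 8 * c) * y
       + (+ 4 * w * w - + 4 * c * w + + 25 - + 10 * a - + 4 * d))
      + (+ 2 * x + - + 5) * (+ 2 * x + + 5 + + 2 * y * (w - + 2 * y) - + 2 * a)
  expanded = solve-∀
  p^n∣4F : ∀ n → p ^ᶻ n ∣ + 4 * Fℤ a b c d (x n) (y n) (z n)
  p^n∣4F n = subst (_ ∣_) (sym (expanded a b c d (x n) (y n) w))
    (∣m∣n⇒∣m+n (proj₂ (proj₂ ys) n) (∣m⇒∣m*n _ (proj₂ (proj₂ xs) n)))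
  p^n∣F : ∀ n → p ^ᶻ n ∣ Fℤ a b c d (x n) (y n) (z n)
  p^n∣F n = ∣ᵤ⇒∣ (ℤC.coprime-divisor (p ^ᶻ n) (+ 4) (Fℤ a b c d (x n) (y n) (z n))
                    (coprime-^ (prime∤⇒coprime pr p∤4) n) (∣⇒∣ᵤ (p^n∣4F n)))

-- A rational point

ι : ℤ → ℚ
ι i = i ℚ./ 1

ι-+ : ∀ i j → ι (i + j) ≡ ι i ℚ.+ ι j
ι-+ i j = ℚP.toℚᵘ-injective (begin
  ℚ.toℚᵘ (ι (i + j))                 ≈⟨ ℚP.toℚᵘ-fromℚᵘ (mkℚᵘ (i + j) 0) ⟩
  mkℚᵘ (i + j) 0                     ≈⟨ *≡* (lemma i j) ⟩
  mkℚᵘ i 0 ℚᵘ.+ mkℚᵘ j 0             ≈⟨ ℚᵘP.+-cong (ℚP.toℚᵘ-fromℚᵘ (mkℚᵘ i 0)) (ℚP.toℚᵘ-fromℚᵘ (mkℚᵘ j 0)) ⟨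
  ℚ.toℚᵘ (ι i) ℚᵘ.+ ℚ.toℚᵘ (ι j)     ≈⟨ ℚP.toℚᵘ-homo-+ (ι i) (ι j) ⟨
  ℚ.toℚᵘ (ι i ℚ.+ ι j)               ∎)
  where
  open ℚᵘP.≃-Reasoning
  lemma : ∀ i j → (i + j) * + 1 ≡ (i * + 1 + j * + 1) * + 1
  lemma = solve-∀

ι≡0⇒≡0 : ∀ i → ι i ≡ 0ℚ → i ≡ + 0
ι≡0⇒≡0 i ι[i]≡0 = begin
  i                           ≡⟨ ℚP.↥-/ i 1 ⟨
  ℚ.↥ (ι i) * gcd i (+ 1)     ≡⟨ cong (ℚ.↥ (ι i) *_) (gcd-zeroʳ i) ⟩
  ℚ.↥ (ι i) * + 1             ≡⟨ ℤP.*-identityʳ (ℚ.↥ (ι i)) ⟩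
  ℚ.↥ (ι i)                   ≡⟨ cong ℚ.↥_ ι[i]≡0 ⟩
  + 0                         ∎
  where open ≡-Reasoning

0≤inv : ∀ m → 0ℚ ℚ.≤ inv m
0≤inv m = ℚP.nonNegative⁻¹ (inv m) {{ℚP.normalize-nonNeg 1 (suc m)}}

constant-regular : ∀ x → IsRegular (λ _ → x)
constant-regular x m n = subst (λ t → ℚ.∣ t ∣ ℚ.≤ inv m ℚ.+ inv n) (sym (ℚP.+-inverseʳ x))
                           (ℚP.+-mono-≤ (0≤inv m) (0≤inv n))

RealPoint-of-rational : ∀ a b c d x y z → Fℚ a b c d x y z ≡ 0ℚ → RealPoint a b c d
RealPoint-of-rational a b c d x y z F≡0 =
  (λ _ → x) , (λ _ → y) , (λ _ → z) ,
  constant-regular x , constant-regular y , constant-regular z ,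
  λ k → 0 , λ _ _ → subst (λ t → ℚ.∣ t ∣ ℚ.≤ inv k) (sym F≡0) (0≤inv k)

ℚ-ring : AlmostCommutativeRing 0ℓ 0ℓ
ℚ-ring = fromCommutativeRing ℚP.+-*-commutativeRing (λ _ → nothing)


RealPoint-diagonal : ∀ a b c d → b + c ≢ + 0 → RealPoint a b c d
RealPoint-diagonal a b c d b+c≢0 = RealPoint-of-rational a b c d x y y F≡0
  where
  open ≡-Reasoning
  x S N y : ℚ
  x = ι (- + 2)
  S = ι b ℚ.+ ι c
  N = x ℚ.* x ℚ.- ι a ℚ.* x ℚ.- ι d
  instance
    S-nonZero : ℚ.NonZero S
    S-nonZero = ℚ.≢-nonZero λ S≡0 → b+c≢0 (ι≡0⇒≡0 (b + c) (trans (ι-+ b c) S≡0))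
  y = N ℚ.* ℚ.1/ S
  expanded : ∀ x y a b c d →
    (x ℚ.* x ℚ.+ y ℚ.* y ℚ.+ y ℚ.* y ℚ.+ x ℚ.* y ℚ.* y) ℚ.- (a ℚ.* x ℚ.+ b ℚ.* y ℚ.+ c ℚ.* y ℚ.+ d)
    ≡ ((x ℚ.* x ℚ.- a ℚ.* x ℚ.- d) ℚ.- (b ℚ.+ c) ℚ.* y) ℚ.+ (1ℚ ℚ.+ 1ℚ ℚ.+ x) ℚ.* (y ℚ.* y)
  expanded = RingSolver.solve-∀ ℚ-ring
  lemma : ∀ S N T → S ℚ.* (N ℚ.* T) ≡ N ℚ.* (S ℚ.* T)
  lemma = RingSolver.solve-∀ ℚ-ring
  Sy≡N : S ℚ.* y ≡ N
  Sy≡N = begin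
    S ℚ.* (N ℚ.* ℚ.1/ S)   ≡⟨ lemma S N (ℚ.1/ S) ⟩
    N ℚ.* (S ℚ.* ℚ.1/ S)   ≡⟨ cong (N ℚ.*_) (ℚP.*-inverseʳ S) ⟩
    N ℚ.* 1ℚ               ≡⟨ ℚP.*-identityʳ N ⟩
    N                      ∎
  -- The coefficient 1 + 1 + x of y² is the closed term 0, so ℚP.*-zeroˡ applies.
  F≡0 : Fℚ a b c d x y y ≡ 0ℚ
  F≡0 = begin
    Fℚ a b c d x y y                                    ≡⟨ expanded x y (ι a) (ι b) (ι c) (ι d) ⟩
    (N ℚ.- S ℚ.* y) ℚ.+ (1ℚ ℚ.+ 1ℚ ℚ.+ x) ℚ.* (y ℚ.* y) ≡⟨ cong (λ t → (N ℚ.- S ℚ.* y) ℚ.+ t) (ℚP.*-zeroˡ (y ℚ.* y)) ⟩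
    (N ℚ.- S ℚ.* y) ℚ.+ 0ℚ                              ≡⟨ ℚP.+-identityʳ (N ℚ.- S ℚ.* y) ⟩
    N ℚ.- S ℚ.* y                                       ≡⟨ cong (λ t → N ℚ.- t) Sy≡N ⟩
    N ℚ.- N                                             ≡⟨ ℚP.+-inverseʳ N ⟩
    0ℚ                                                  ∎

proposition4p1 : (k₁ k₂ k₃ k₄ : ℤ) →
    OutsideMinus2To2 k₁ → OutsideMinus2To2 k₂ →
    OutsideMinus2To2 k₃ → OutsideMinus2To2 k₄ →
    k₁ ≡ - (+ 1) [mod + 16 ] → k₂ ≡ + 5 [mod + 16 ] →
    k₃ ≡ + 5 [mod + 16 ] → k₄ ≡ + 5 [mod + 16 ] →
    k₁ ≡ + 1 [mod + 9 ] → k₂ ≡ + 5 [mod + 9 ] →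
    k₃ ≡ + 5 [mod + 9 ] → k₄ ≡ + 5 [mod + 9 ] →
    PairCond k₁ k₂ → PairCond k₁ k₃ → PairCond k₁ k₄ →
    PairCond k₂ k₃ → PairCond k₂ k₄ → PairCond k₃ k₄ →
    gcd4 (sq-2 k₁) (sq-2 k₂) (sq-2 k₃) (sq-2 k₄) ≡ + 1 →
    AdelicPointsNonempty (coefA k₁ k₂ k₃ k₄) (coefB k₁ k₂ k₃ k₄)
                         (coefC k₁ k₂ k₃ k₄) (coefD k₁ k₂ k₃ k₄)
proposition4p1 k₁ k₂ k₃ k₄ _ _ _ _ h₁ h₂ h₃ h₄ g₁ g₂ g₃ g₄ _ _ _ _ _ _ _ =
  Zp-points , RealPoint-diagonal a b c d (≅6-mod-9⇒≢0 (proj₁ mod-9))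
  where
  a b c d : ℤ
  a = coefA k₁ k₂ k₃ k₄
  b = coefB k₁ k₂ k₃ k₄
  c = coefC k₁ k₂ k₃ k₄
  d = coefD k₁ k₂ k₃ k₄
  mod-16⇒mod-8 : ∀ k r → k ≡ r [mod + 16 ] → k ≅ r ⟨mod + 8 ⟩
  mod-16⇒mod-8 k r k≡r = ≅-weaken (divides (+ 2) refl) (≡-mod⇒≅ k r k≡r)
  mod-8 : c ≅ + 4 ⟨mod + 8 ⟩ × d ≅ + 5 ⟨mod + 8 ⟩
  mod-8 = residues-mod-8 (mod-16⇒mod-8 k₁ (- + 1) h₁) (mod-16⇒mod-8 k₂ (+ 5) h₂)
                         (mod-16⇒mod-8 k₃ (+ 5) h₃) (mod-16⇒mod-8 k₄ (+ 5) h₄)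
  mod-9 : b + c ≅ + 6 ⟨mod + 9 ⟩ × + 4 + + 2 * a - d ≅ + 0 ⟨mod + 9 ⟩
  mod-9 = residues-mod-9 (≡-mod⇒≅ k₁ (+ 1) g₁) (≡-mod⇒≅ k₂ (+ 5) g₂)
                         (≡-mod⇒≅ k₃ (+ 5) g₃) (≡-mod⇒≅ k₄ (+ 5) g₄)
  Zp-points : ∀ p → Prime p → ZpPoint p a b c d
  Zp-points p pr with p ℕ.≟ 2 | p ℕ.≟ 3
  ... | yes refl | _        = ZpPoint-axis a b c d (proj₁ mod-8) (proj₂ mod-8)
  ... | no _     | yes refl = ZpPoint-3 a b c d (proj₁ mod-9) (proj₂ mod-9)
  ... | no p≢2   | no p≢3   = ZpPoint-plane a b c d pr p≢2 p≢3
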